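{- Let $m\geq 1$ and let $K_{m,2}$ be the complete bipartite graph with parts $\{v_0,v_1,\ldots,v_{m-1}\}$ and $\{v_m,v_{m+1}\}$, with sink $v_0$. Its lacking polynomial is $$L_{m,2}(x)=\sum_{k=0}^{m-1}S(m-1,k)x^k,\qquad\text{where } S(m-1,k)=\sum_{q=0}^{k}\sum_{r=0}^{q}\binom{m-1}{r}\ \text{ for } 0\leq k\leq m-1.$$
   Context: Let $G$ be a finite connected loop-free graph with a distinguished sink vertex $s$. A configuration assigns a non-negative integer $c(v)$ to each non-sink vertex $v$; it is stable if $c(v)<d(v)$ for every non-sink $v$, where $d(v)$ is the degree. For an orientation $\mathcal{O}$ of $G$, $\mathrm{in}_{\mathcal{O}}(v)$ is the number of edges directed into $v$; $c$ is compatible with $\mathcal{O}$ if $\mathrm{in}_{\mathcal{O}}(v)\geq d(v)-c(v)$ for every non-sink $v$. The set $\mathsf{Sto}(G)$ of stochastically recurrent states is the set of stable configurations compatible with at least one orientation of $G$. The lacking polynomial is $L_G(x)=\sum_{c\in\mathsf{Sto}(G)}x^{\ell(c)}$, where $\ell(c)=\sum_{v\neq s}(d(v)-c(v)-1)$. $L_{m,2}$ denotes $L_{K_{m,2}}$ with sink $v_0$. -}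

module Defs where

open import Data.Nat using (ℕ; zero; suc; _+_; _∸_; _≤_; _<_)
open import Data.Nat.Combinatorics using (_C_)
open import Data.Bool using (Bool; true; false; if_then_else_)
open import Data.Fin using (Fin; zero; suc; inject₁; fromℕ; _≟_)
open import Data.Nat.ListAction using (sum)
open import Data.List using (List; []; _∷_; length; map; allFin; upTo; concatMap)
open import Data.List.Membership.Propositional using (_∈_)
open import Data.List.Relation.Unary.Unique.Propositional using (Unique)
open import Data.Vec using (Vec; lookup)
open import Data.Product using (_×_; _,_; proj₁; proj₂; ∃; ∃-syntax)
open import Data.List using () renaming (lookup to lookupL)
open import Relation.Binary.PropositionalEquality using (_≡_)
open import Function.Bundles using (_⇔_)
open import Relation.Nullary.Decidable using (does)

-- A finite (multi)graph on vertex set Fin (suc n), given by its list of edges.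
-- The sink is always the vertex `zero`; the non-sink vertices are `suc i`, i : Fin n.
record Graph (n : ℕ) : Set where
  field
    edges : List (Fin (suc n) × Fin (suc n))
open Graph public

[_≡ᵛ_] : ∀ {k} → Fin k → Fin k → ℕ
[ u ≡ᵛ v ] = if does (u ≟ v) then 1 else 0

deg : ∀ {n} → Graph n → Fin (suc n) → ℕ
deg G v = sum (map (λ e → [ proj₁ e ≡ᵛ v ] + [ proj₂ e ≡ᵛ v ]) (edges G))

-- An orientation chooses, for each edge (a , b), a direction:
-- true means a → b (head b), false means b → a (head a).
Orientation : ∀ {n} → Graph n → Set
Orientation G = Fin (length (edges G)) → Bool

head : ∀ {n} (G : Graph n) → Orientation G → Fin (length (edges G)) → Fin (suc n)
head G O i with lookupL (edges G) i
... | (a , b) = if O i then b else a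

indeg : ∀ {n} (G : Graph n) → Orientation G → Fin (suc n) → ℕ
indeg G O v = sum (map (λ i → [ head G O i ≡ᵛ v ]) (allFin (length (edges G))))

Config : ℕ → Set
Config n = Vec ℕ n

Stable : ∀ {n} → Graph n → Config n → Set
Stable {n} G c = (i : Fin n) → lookup c i < deg G (suc i)

-- in_O(v) ≥ d(v) - c(v) for every non-sink v (truncated subtraction is harmless:
-- if d(v) - c(v) < 0 the condition holds trivially either way)
Compatible : ∀ {n} (G : Graph n) → Config n → Orientation G → Set
Compatible {n} G c O = (i : Fin n) → deg G (suc i) ∸ lookup c i ≤ indeg G O (suc i)

InSto : ∀ {n} → Graph n → Config n → Set
InSto G c = Stable G c × ∃[ O ] Compatible G c O

-- ℓ(c) = Σ_{v ≠ s} (d(v) - c(v) - 1)   (non-negative on stable configurations)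
lacking : ∀ {n} → Graph n → Config n → ℕ
lacking {n} G c = sum (map (λ i → deg G (suc i) ∸ lookup c i ∸ 1) (allFin n))

-- The coefficient of x^k in L_G(x) = Σ_{c ∈ Sto(G)} x^{ℓ(c)} is the number of
-- c ∈ Sto(G) with ℓ(c) = k.  "LackingCoeff G k N" says this number is N:
-- there is a duplicate-free list enumerating exactly those configurations, of length N.
LackingCoeff : ∀ {n} → Graph n → ℕ → ℕ → Set
LackingCoeff {n} G k N =
  ∃[ xs ] (Unique xs × ((c : Config n) → (c ∈ xs) ⇔ (InSto G c × lacking G c ≡ k)) × length xs ≡ N)

-- K_{m,2}: vertices v_0..v_{m+1} = Fin (suc (suc m)); v_i (i < m) adjacent to v_m and v_{m+1}.
-- Sink v_0 = zero.
Kₘ₂ : (m : ℕ) → Graph (suc m)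
Kₘ₂ m = record { edges = concatMap (λ i → (left i , vm) ∷ (left i , vm1) ∷ []) (allFin m) }
  where
  left : Fin m → Fin (suc (suc m))
  left i = inject₁ (inject₁ i)
  vm : Fin (suc (suc m))
  vm = inject₁ (fromℕ m)
  vm1 : Fin (suc (suc m))
  vm1 = fromℕ (suc m)

S : ℕ → ℕ → ℕ
S N k = sum (map (λ q → sum (map (λ r → N C r) (upTo (suc q)))) (upTo (suc k)))

{-# OPTIONS --safe #-}
module Submission where

open import Defs
open import Data.Nat.Properties
  using ( module ≤-Reasoning; +-commutativeSemigroup; +-comm; +-suc; +-identityʳ; *-identityʳ; *-zeroʳ
        ; ≤-refl; ≤-trans; ≤-reflexive; <⇒≢; <⇒≱; n<1+n; m<n⇒m<1+n; m≤m+n; m≤n+m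
        ; +-mono-≤; +-cancelˡ-≤; +-cancelʳ-≤; 0∸n≡0; m∸n≤m; ∸-+-assoc; m<n⇒0<n∸m
        ; m∸n+n≡m; m+n∸m≡n; m+[n∸m]≡n; m∸[m∸n]≡n)
open import Algebra.Properties.CommutativeSemigroup +-commutativeSemigroup using (interchange)
open import Data.Bool using (Bool; true; false; if_then_else_; T?)
open import Data.Fin using (Fin; zero; suc; _≟_; toℕ; inject₁; fromℕ)
open import Data.Fin.Properties using (toℕ-inject₁; toℕ-fromℕ; inject₁-injective; toℕ<n)
import Data.List as List
open import Data.List using (List; []; _∷_; _++_; length; map; allFin; upTo; concatMap; tabulate)
open import Data.List.Properties using (map-++; map-tabulate; tabulate-lookup; length-map; length-++)
open import Data.List.Membership.Propositional using (_∈_; find; lose)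
open import Data.List.Membership.Propositional.Properties
  using (∈-map⁺; ∈-map⁻; ∈-++⁺ˡ; ∈-++⁺ʳ; ∈-++⁻; ∈-concatMap⁺; ∈-concatMap⁻; ∈-upTo⁺; ∈-upTo⁻)
open import Data.List.Relation.Binary.Disjoint.Propositional using (Disjoint)
open import Data.List.Relation.Unary.All as ListAll using ([])
open import Data.List.Relation.Unary.Any using (here; there)
open import Data.List.Relation.Unary.Unique.Propositional using (Unique; []; _∷_)
open import Data.List.Relation.Unary.Unique.Propositional.Properties using (map⁺; ++⁺; upTo⁺)
open import Data.Nat using (ℕ; zero; suc; _+_; _*_; _∸_; _≤_; _<_; _≡ᵇ_; z≤n; s≤s; s≤s⁻¹)
open import Data.Nat.Combinatorics using (_C_; nCk+nC[k+1]≡[n+1]C[k+1])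
open import Data.Nat.ListAction using (sum)
open import Data.Nat.ListAction.Properties using (sum-++)
open import Data.Nat.Tactic.RingSolver using (solve-∀)
open import Data.Product using (_×_; _,_; proj₁; proj₂; ∃-syntax; uncurry)
open import Data.Sum using (inj₁; inj₂)
open import Data.Vec using (Vec; []; _∷_; lookup; countᵇ)
open import Data.Vec.Properties using (∷-injectiveˡ; ∷-injectiveʳ; count≤n)
open import Data.Vec.Relation.Unary.All using (All; []; _∷_)
open import Data.Vec.Relation.Unary.All.Properties using (lookup⁺; lookup⁻)
open import Function using (_∘_)
open import Function.Bundles using (mk⇔)
open import Relation.Binary.PropositionalEquality
  using (_≡_; _≢_; refl; sym; trans; cong; cong₂; subst; subst₂; module ≡-Reasoning)
open import Relation.Nullary.Decidable using (does; dec-true; dec-false)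
open import Relation.Nullary.Negation using (contradiction)

-- Write m = n + 1.  A configuration of Kₘ₂ consists of values on the n non-sink
-- left vertices, of degree 2, and values a, b on vₘ, vₘ₊₁, of degree n + 1; it is
-- stable when the left values are 0 or 1 and a, b ≤ n, and then its lacking number
-- is (number of zeros) + (n ∸ a) + (n ∸ b).
--
-- Summing d(v) ∸ c(v) ≤ in(v) over the non-sink vertices shows ℓ(c) ≤ |E| − n − 2 = n
-- on Sto.  Conversely, if ℓ(c) ≤ n, orient both edges of the sink outwards, both edges
-- of every left vertex holding 0 inwards, and let n ∸ a of the left vertices holding 1
-- send one edge into vₘ and the others one edge into vₘ₊₁: this orientation is compatible.
-- Hence the coefficient of x^k, for k ≤ n, counts the choices of r zeros among the n
-- left vertices (n C r ways) together with a split of k ∸ r between vₘ and vₘ₊₁.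

sum-map-+ : ∀ {A : Set} (f g : A → ℕ) (xs : List A) →
  sum (map (λ x → f x + g x) xs) ≡ sum (map f xs) + sum (map g xs)
sum-map-+ f g [] = refl
sum-map-+ f g (x ∷ xs) = begin
  f x + g x + sum (map (λ x → f x + g x) xs)    ≡⟨ cong (f x + g x +_) (sum-map-+ f g xs) ⟩
  f x + g x + (sum (map f xs) + sum (map g xs)) ≡⟨ interchange (f x) (g x) _ _ ⟩
  f x + sum (map f xs) + (g x + sum (map g xs)) ∎
  where open ≡-Reasoning

sum-map-cong : ∀ {A : Set} {f g : A → ℕ} (xs : List A) → (∀ x → f x ≡ g x) →
  sum (map f xs) ≡ sum (map g xs)
sum-map-cong [] f≗g = refl
sum-map-cong (x ∷ xs) f≗g = cong₂ _+_ (f≗g x) (sum-map-cong xs f≗g)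

sum-map-mono-≤ : ∀ {A : Set} {f g : A → ℕ} (xs : List A) → (∀ x → f x ≤ g x) →
  sum (map f xs) ≤ sum (map g xs)
sum-map-mono-≤ [] f≤g = z≤n
sum-map-mono-≤ (x ∷ xs) f≤g = +-mono-≤ (f≤g x) (sum-map-mono-≤ xs f≤g)

sum-map-concatMap : ∀ {A B : Set} (h : B → ℕ) (g : A → List B) (xs : List A) →
  sum (map h (concatMap g xs)) ≡ sum (map (λ x → sum (map h (g x))) xs)
sum-map-concatMap h g [] = refl
sum-map-concatMap h g (x ∷ xs) = begin
  sum (map h (g x ++ concatMap g xs))              ≡⟨ cong sum (map-++ h (g x) _) ⟩
  sum (map h (g x) ++ map h (concatMap g xs))      ≡⟨ sum-++ (map h (g x)) _ ⟩
  sum (map h (g x)) + sum (map h (concatMap g xs)) ≡⟨ cong (sum (map h (g x)) +_) (sum-map-concatMap h g xs) ⟩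
  sum (map h (g x)) + sum (map (λ x → sum (map h (g x))) xs) ∎
  where open ≡-Reasoning

sum-map-comm : ∀ {A B : Set} (F : A → B → ℕ) (xs : List A) (ys : List B) →
  sum (map (λ x → sum (map (F x) ys)) xs) ≡ sum (map (λ y → sum (map (λ x → F x y) xs)) ys)
sum-map-comm F [] ys = sym (sum-map-zero ys)
  where
  sum-map-zero : ∀ {B : Set} (ys : List B) → sum (map (λ _ → 0) ys) ≡ 0
  sum-map-zero [] = refl
  sum-map-zero (_ ∷ ys) = sum-map-zero ys
sum-map-comm F (x ∷ xs) ys = begin
  sum (map (F x) ys) + sum (map (λ x → sum (map (F x) ys)) xs)
    ≡⟨ cong (sum (map (F x) ys) +_) (sum-map-comm F xs ys) ⟩
  sum (map (F x) ys) + sum (map (λ y → sum (map (λ x → F x y) xs)) ys)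
    ≡⟨ sum-map-+ (F x) _ ys ⟨
  sum (map (λ y → F x y + sum (map (λ x → F x y) xs)) ys) ∎
  where open ≡-Reasoning

length-concatMap : ∀ {A B : Set} (f : A → List B) (xs : List A) →
  length (concatMap f xs) ≡ sum (map (length ∘ f) xs)
length-concatMap f [] = refl
length-concatMap f (x ∷ xs) = trans (length-++ (f x)) (cong (length (f x) +_) (length-concatMap f xs))

∈-concatMap⁻′ : ∀ {A B : Set} (f : A → List B) {y} (xs : List A) →
  y ∈ concatMap f xs → ∃[ x ] x ∈ xs × y ∈ f x
∈-concatMap⁻′ f xs y∈ = find (∈-concatMap⁻ f y∈)

∈-concatMap⁺′ : ∀ {A B : Set} (f : A → List B) {x y} {xs : List A} → x ∈ xs → y ∈ f x → y ∈ concatMap f xs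
∈-concatMap⁺′ f x∈ y∈ = ∈-concatMap⁺ f (lose x∈ y∈)

concatMap-unique : ∀ {A B : Set} {f : A → List B} (block : B → A) {xs : List A} → Unique xs →
  (∀ {x} → x ∈ xs → Unique (f x)) → (∀ {x y} → x ∈ xs → y ∈ f x → block y ≡ x) →
  Unique (concatMap f xs)
concatMap-unique block [] _ _ = []
concatMap-unique {f = f} block {x ∷ xs} (x∉xs ∷ xs-unique) f-unique f-block =
  ++⁺ (f-unique (here refl)) (concatMap-unique block xs-unique (f-unique ∘ there) (f-block ∘ there)) disjoint
  where
  disjoint : Disjoint (f x) (concatMap f xs)
  disjoint (y∈fx , y∈rest) with ∈-concatMap⁻′ f xs y∈rest
  ... | x′ , x′∈xs , y∈fx′ =
    ListAll.lookup x∉xs x′∈xs (trans (sym (f-block (here refl) y∈fx)) (f-block (there x′∈xs) y∈fx′))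

sum-allFin-suc : ∀ {n} (f : Fin (suc n) → ℕ) →
  sum (map f (allFin (suc n))) ≡ f zero + sum (map (f ∘ suc) (allFin n))
sum-allFin-suc f = cong (λ xs → f zero + sum xs)
  (trans (map-tabulate suc f) (sym (map-tabulate (λ j → j) (f ∘ suc))))

sum-allFin-lookup : ∀ {A : Set} (F : A → ℕ) (xs : List A) →
  sum (map (F ∘ List.lookup xs) (allFin (length xs))) ≡ sum (map F xs)
sum-allFin-lookup F xs = cong sum (begin
  map (F ∘ List.lookup xs) (allFin (length xs)) ≡⟨ map-tabulate (λ i → i) _ ⟩
  tabulate (F ∘ List.lookup xs)                 ≡⟨ map-tabulate (List.lookup xs) F ⟨
  map F (tabulate (List.lookup xs))             ≡⟨ cong (map F) (tabulate-lookup xs) ⟩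
  map F xs                                      ∎)
  where open ≡-Reasoning

sum-allFin-const : ∀ n {g : Fin n → ℕ} {c} → (∀ j → g j ≡ c) → sum (map g (allFin n)) ≡ n * c
sum-allFin-const zero g≡c = refl
sum-allFin-const (suc n) {g} g≡c =
  trans (sum-allFin-suc g) (cong₂ _+_ (g≡c zero) (sum-allFin-const n (g≡c ∘ suc)))

sum-allFin-single : ∀ {n} (g : Fin n → ℕ) (j₀ : Fin n) → (∀ j → j ≢ j₀ → g j ≡ 0) →
  sum (map g (allFin n)) ≡ g j₀
sum-allFin-single {suc n} g zero others = begin
  sum (map g (allFin (suc n)))               ≡⟨ sum-allFin-suc g ⟩
  g zero + sum (map (g ∘ suc) (allFin n))    ≡⟨ cong (g zero +_) (sum-allFin-const n (λ j → others (suc j) λ ())) ⟩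
  g zero + n * 0                             ≡⟨ cong (g zero +_) (*-zeroʳ n) ⟩
  g zero + 0                                 ≡⟨ +-identityʳ (g zero) ⟩
  g zero                                     ∎
  where open ≡-Reasoning
sum-allFin-single {suc n} g (suc j₀) others = begin
  sum (map g (allFin (suc n)))               ≡⟨ sum-allFin-suc g ⟩
  g zero + sum (map (g ∘ suc) (allFin n))
    ≡⟨ cong₂ _+_ (others zero λ ()) (sum-allFin-single (g ∘ suc) j₀ others-suc) ⟩
  g (suc j₀) ∎
  where
  open ≡-Reasoning
  others-suc : ∀ j → j ≢ j₀ → g (suc j) ≡ 0
  others-suc j j≢j₀ = others (suc j) λ { refl → j≢j₀ refl }

sum-allFin-countᵇ : ∀ {A : Set} {n} (p : A → Bool) (xs : Vec A n) →
  sum (map (λ j → if p (lookup xs j) then 1 else 0) (allFin n)) ≡ countᵇ p xs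
sum-allFin-countᵇ p [] = refl
sum-allFin-countᵇ p (x ∷ xs)
  rewrite sum-allFin-suc (λ j → if p (lookup (x ∷ xs) j) then 1 else 0) | sum-allFin-countᵇ p xs
  with p x
... | true  = refl
... | false = refl

[x≡ᵛx]≡1 : ∀ {k} (x : Fin k) → [ x ≡ᵛ x ] ≡ 1
[x≡ᵛx]≡1 x rewrite dec-true (x ≟ x) refl = refl

[x≡ᵛy]≡0 : ∀ {k} {x y : Fin k} → x ≢ y → [ x ≡ᵛ y ] ≡ 0
[x≡ᵛy]≡0 {x = x} {y} x≢y rewrite dec-false (x ≟ y) x≢y = refl

[if-α-then-v]≡ : ∀ {k} α {x v : Fin k} → x ≢ v → [ (if α then v else x) ≡ᵛ v ] ≡ (if α then 1 else 0)
[if-α-then-v]≡ true {v = v} x≢v = [x≡ᵛx]≡1 v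
[if-α-then-v]≡ false x≢v = [x≡ᵛy]≡0 x≢v

[if-α-else-x]≡ : ∀ {k} α {x y : Fin k} → y ≢ x → [ (if α then y else x) ≡ᵛ x ] ≡ (if α then 0 else 1)
[if-α-else-x]≡ true y≢x = [x≡ᵛy]≡0 y≢x
[if-α-else-x]≡ false {x = x} y≢x = [x≡ᵛx]≡1 x

[if]≡0 : ∀ {k} α {x y v : Fin k} → y ≢ v → x ≢ v → [ (if α then y else x) ≡ᵛ v ] ≡ 0
[if]≡0 true y≢v x≢v = [x≡ᵛy]≡0 y≢v
[if]≡0 false y≢v x≢v = [x≡ᵛy]≡0 x≢v

sum-indicator : ∀ n (w : Fin n) → sum (map (λ v → [ w ≡ᵛ v ]) (allFin n)) ≡ 1
sum-indicator n w = trans (sum-allFin-single _ w (λ v v≢w → [x≡ᵛy]≡0 (v≢w ∘ sym))) ([x≡ᵛx]≡1 w)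

-- In-degrees in an arbitrary graph

handshake : ∀ {n} (G : Graph n) (O : Orientation G) →
  sum (map (indeg G O) (allFin (suc n))) ≡ length (edges G)
handshake {n} G O = begin
  sum (map (indeg G O) (allFin (suc n)))
    ≡⟨ sum-map-comm (λ v i → [ head G O i ≡ᵛ v ]) (allFin (suc n)) (allFin (length (edges G))) ⟩
  sum (map (λ i → sum (map (λ v → [ head G O i ≡ᵛ v ]) (allFin (suc n)))) (allFin (length (edges G))))
    ≡⟨ sum-allFin-const _ (λ i → sum-indicator (suc n) (head G O i)) ⟩
  length (edges G) * 1
    ≡⟨ *-identityʳ _ ⟩
  length (edges G) ∎
  where open ≡-Reasoning

lacking+n≤#edges : ∀ {n} (G : Graph n) (c : Config n) → InSto G c → lacking G c + n ≤ length (edges G)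
lacking+n≤#edges {n} G c (stable , O , compatible) = begin
  lacking G c + n                                        ≡⟨ cong (lacking G c +_) (*-identityʳ n) ⟨
  lacking G c + n * 1                                    ≡⟨ cong (lacking G c +_) (sum-allFin-const n λ _ → refl) ⟨
  lacking G c + sum (map (λ _ → 1) (allFin n))           ≡⟨ sum-map-+ deficit (λ _ → 1) (allFin n) ⟨
  sum (map (λ i → deficit i + 1) (allFin n))             ≤⟨ sum-map-mono-≤ (allFin n) deficit+1≤indeg ⟩
  sum (map (indeg G O ∘ suc) (allFin n))                 ≤⟨ m≤n+m _ (indeg G O zero) ⟩
  indeg G O zero + sum (map (indeg G O ∘ suc) (allFin n)) ≡⟨ sum-allFin-suc (indeg G O) ⟨
  sum (map (indeg G O) (allFin (suc n)))                 ≡⟨ handshake G O ⟩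
  length (edges G)                                       ∎
  where
  open ≤-Reasoning
  deficit : Fin n → ℕ
  deficit i = deg G (suc i) ∸ lookup c i ∸ 1
  deficit+1≤indeg : ∀ i → deficit i + 1 ≤ indeg G O (suc i)
  deficit+1≤indeg i = ≤-trans (≤-reflexive (m∸n+n≡m (m<n⇒0<n∸m (stable i)))) (compatible i)

orientBy : ∀ {n} (G : Graph n) → (Fin (suc n) × Fin (suc n) → Bool) → Orientation G
orientBy G intoSecond i = intoSecond (List.lookup (edges G) i)

headBy : ∀ {n} → (Fin (suc n) × Fin (suc n) → Bool) → Fin (suc n) × Fin (suc n) → Fin (suc n)
headBy intoSecond (a , b) = if intoSecond (a , b) then b else a

indeg-orientBy : ∀ {n} (G : Graph n) intoSecond v →
  indeg G (orientBy G intoSecond) v ≡ sum (map (λ e → [ headBy intoSecond e ≡ᵛ v ]) (edges G))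
indeg-orientBy G intoSecond v = sum-allFin-lookup (λ e → [ headBy intoSecond e ≡ᵛ v ]) (edges G)

-- The graph Kₘ₂

-- These are, definitionally, the vertex names used in the definition of Kₘ₂.
left : ∀ {m} → Fin m → Fin (suc (suc m))
left j = inject₁ (inject₁ j)

vₘ : ∀ m → Fin (suc (suc m))
vₘ m = inject₁ (fromℕ m)

vₘ₊₁ : ∀ m → Fin (suc (suc m))
vₘ₊₁ m = fromℕ (suc m)

toℕ-left : ∀ {m} (j : Fin m) → toℕ (left j) ≡ toℕ j
toℕ-left j = trans (toℕ-inject₁ (inject₁ j)) (toℕ-inject₁ j)

toℕ-vₘ : ∀ m → toℕ (vₘ m) ≡ m
toℕ-vₘ m = trans (toℕ-inject₁ (fromℕ m)) (toℕ-fromℕ m)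

left-injective : ∀ {m} {i j : Fin m} → left i ≡ left j → i ≡ j
left-injective = inject₁-injective ∘ inject₁-injective

left≢vₘ : ∀ {m} (j : Fin m) → left j ≢ vₘ m
left≢vₘ {m} j j≡m = <⇒≢ (toℕ<n j) (begin
  toℕ j        ≡⟨ toℕ-left j ⟨
  toℕ (left j) ≡⟨ cong toℕ j≡m ⟩
  toℕ (vₘ m)   ≡⟨ toℕ-vₘ m ⟩
  m            ∎)
  where open ≡-Reasoning

left≢vₘ₊₁ : ∀ {m} (j : Fin m) → left j ≢ vₘ₊₁ m
left≢vₘ₊₁ {m} j j≡m+1 = <⇒≢ (m<n⇒m<1+n (toℕ<n j)) (begin
  toℕ j          ≡⟨ toℕ-left j ⟨
  toℕ (left j)   ≡⟨ cong toℕ j≡m+1 ⟩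
  toℕ (vₘ₊₁ m)   ≡⟨ toℕ-fromℕ (suc m) ⟩
  suc m          ∎)
  where open ≡-Reasoning

vₘ≢vₘ₊₁ : ∀ m → vₘ m ≢ vₘ₊₁ m
vₘ≢vₘ₊₁ m m≡m+1 = <⇒≢ (n<1+n m) (begin
  m              ≡⟨ toℕ-vₘ m ⟨
  toℕ (vₘ m)     ≡⟨ cong toℕ m≡m+1 ⟩
  toℕ (vₘ₊₁ m)   ≡⟨ toℕ-fromℕ (suc m) ⟩
  suc m          ∎)
  where open ≡-Reasoning

vertex-cases : ∀ {n} (P : Fin (suc (suc n)) → Set) →
  (∀ j → P (left j)) → P (vₘ n) → P (vₘ₊₁ n) → ∀ v → P v
vertex-cases {zero} P P-left P-vₘ P-vₘ₊₁ zero = P-vₘ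
vertex-cases {zero} P P-left P-vₘ P-vₘ₊₁ (suc zero) = P-vₘ₊₁
vertex-cases {suc n} P P-left P-vₘ P-vₘ₊₁ zero = P-left zero
vertex-cases {suc n} P P-left P-vₘ P-vₘ₊₁ (suc v) =
  vertex-cases (P ∘ suc) (P-left ∘ suc) P-vₘ P-vₘ₊₁ v

sum-vertices : ∀ n (f : Fin (suc (suc n)) → ℕ) →
  sum (map f (allFin (suc (suc n)))) ≡ sum (map (f ∘ left) (allFin n)) + f (vₘ n) + f (vₘ₊₁ n)
sum-vertices zero f =
  trans (sum-allFin-suc f) (cong (f zero +_) (trans (sum-allFin-suc (f ∘ suc)) (+-identityʳ _)))
sum-vertices (suc n) f = begin
  sum (map f (allFin (suc (suc (suc n)))))                 ≡⟨ sum-allFin-suc f ⟩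
  f zero + sum (map (f ∘ suc) (allFin (suc (suc n))))      ≡⟨ cong (f zero +_) (sum-vertices n (f ∘ suc)) ⟩
  f zero + (sum (map (f ∘ left ∘ suc) (allFin n)) + x + y) ≡⟨ reassoc (f zero) _ x y ⟩
  f zero + sum (map (f ∘ left ∘ suc) (allFin n)) + x + y   ≡⟨ cong (λ s → s + x + y) (sum-allFin-suc (f ∘ left)) ⟨
  sum (map (f ∘ left) (allFin (suc n))) + x + y            ∎
  where
  open ≡-Reasoning
  x = f (vₘ (suc n))
  y = f (vₘ₊₁ (suc n))
  reassoc : ∀ a s x y → a + (s + x + y) ≡ a + s + x + y
  reassoc = solve-∀

sum-edges-Kₘ₂ : ∀ m (g : Fin (suc (suc m)) × Fin (suc (suc m)) → ℕ) →
  sum (map g (edges (Kₘ₂ m))) ≡ sum (map (λ j → g (left j , vₘ m) + g (left j , vₘ₊₁ m)) (allFin m))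
sum-edges-Kₘ₂ m g = trans (sum-map-concatMap g _ (allFin m))
  (sum-map-cong (allFin m) (λ j → cong (g (left j , vₘ m) +_) (+-identityʳ _)))

#edges-Kₘ₂ : ∀ m → length (edges (Kₘ₂ m)) ≡ m * 2
#edges-Kₘ₂ m = trans (length-concatMap _ (allFin m)) (sum-allFin-const m λ _ → refl)

incidences : ∀ m → Fin (suc (suc m)) → Fin m → ℕ
incidences m v j = [ left j ≡ᵛ v ] + [ vₘ m ≡ᵛ v ] + ([ left j ≡ᵛ v ] + [ vₘ₊₁ m ≡ᵛ v ])

deg-vₘ : ∀ m → deg (Kₘ₂ m) (vₘ m) ≡ m
deg-vₘ m = trans (sum-edges-Kₘ₂ m _) (trans (sum-allFin-const m one) (*-identityʳ m))
  where
  one : ∀ j → incidences m (vₘ m) j ≡ 1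
  one j rewrite [x≡ᵛy]≡0 (left≢vₘ j) | [x≡ᵛx]≡1 (vₘ m) | [x≡ᵛy]≡0 (vₘ≢vₘ₊₁ m ∘ sym) = refl

deg-vₘ₊₁ : ∀ m → deg (Kₘ₂ m) (vₘ₊₁ m) ≡ m
deg-vₘ₊₁ m = trans (sum-edges-Kₘ₂ m _) (trans (sum-allFin-const m one) (*-identityʳ m))
  where
  one : ∀ j → incidences m (vₘ₊₁ m) j ≡ 1
  one j rewrite [x≡ᵛy]≡0 (left≢vₘ₊₁ j) | [x≡ᵛx]≡1 (vₘ₊₁ m) | [x≡ᵛy]≡0 (vₘ≢vₘ₊₁ m) = refl

deg-left : ∀ m (j₀ : Fin m) → deg (Kₘ₂ m) (left j₀) ≡ 2
deg-left m j₀ = trans (sum-edges-Kₘ₂ m _) (trans (sum-allFin-single _ j₀ other) two)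
  where
  two : incidences m (left j₀) j₀ ≡ 2
  two rewrite [x≡ᵛx]≡1 (left j₀)
            | [x≡ᵛy]≡0 (left≢vₘ j₀ ∘ sym) | [x≡ᵛy]≡0 (left≢vₘ₊₁ j₀ ∘ sym) = refl
  other : ∀ j → j ≢ j₀ → incidences m (left j₀) j ≡ 0
  other j j≢j₀ rewrite [x≡ᵛy]≡0 (j≢j₀ ∘ left-injective)
                     | [x≡ᵛy]≡0 (left≢vₘ j₀ ∘ sym) | [x≡ᵛy]≡0 (left≢vₘ₊₁ j₀ ∘ sym) = refl

extend : ∀ {A : Set} {n} → Vec A n → A → A → Vec A (suc (suc n))
extend [] a b = a ∷ b ∷ []
extend (x ∷ xs) a b = x ∷ extend xs a b

lookup-extend-left : ∀ {A : Set} {n} (xs : Vec A n) a b j → lookup (extend xs a b) (left j) ≡ lookup xs j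
lookup-extend-left (x ∷ xs) a b zero = refl
lookup-extend-left (x ∷ xs) a b (suc j) = lookup-extend-left xs a b j

lookup-extend-vₘ : ∀ {A : Set} {n} (xs : Vec A n) a b → lookup (extend xs a b) (vₘ n) ≡ a
lookup-extend-vₘ [] a b = refl
lookup-extend-vₘ (x ∷ xs) a b = lookup-extend-vₘ xs a b

lookup-extend-vₘ₊₁ : ∀ {A : Set} {n} (xs : Vec A n) a b → lookup (extend xs a b) (vₘ₊₁ n) ≡ b
lookup-extend-vₘ₊₁ [] a b = refl
lookup-extend-vₘ₊₁ (x ∷ xs) a b = lookup-extend-vₘ₊₁ xs a b

extend-surjective : ∀ {A : Set} {n} (c : Vec A (suc (suc n))) → ∃[ xs ] ∃[ a ] ∃[ b ] c ≡ extend xs a b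
extend-surjective {n = zero} (a ∷ b ∷ []) = [] , a , b , refl
extend-surjective {n = suc n} (x ∷ c) with extend-surjective c
... | xs , a , b , refl = x ∷ xs , a , b , refl

extend-injective : ∀ {A : Set} {n} {xs ys : Vec A n} {a b} → extend xs a b ≡ extend ys a b → xs ≡ ys
extend-injective {xs = []} {[]} refl = refl
extend-injective {xs = x ∷ xs} {y ∷ ys} eq = cong₂ _∷_ (∷-injectiveˡ eq) (extend-injective (∷-injectiveʳ eq))

-- Orientations of Kₘ₂

-- The entry (α , β) of D at the left vertex j says whether the edge to vₘ points into vₘ
-- and whether the edge to vₘ₊₁ points into vₘ₊₁.  The two padding entries of extend are
-- never read: vₘ and vₘ₊₁ are never first endpoints of an edge.
intoSecond : ∀ {m} → Vec (Bool × Bool) m → Fin (suc (suc m)) × Fin (suc (suc m)) → Bool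
intoSecond {m} D (x , y) =
  (if does (y ≟ vₘ m) then proj₁ else proj₂) (lookup (extend D (true , true) (true , true)) x)

orientKₘ₂ : ∀ {m} → Vec (Bool × Bool) m → Orientation (Kₘ₂ m)
orientKₘ₂ {m} D = orientBy (Kₘ₂ m) (intoSecond D)

inEdgesAtLeft : Bool × Bool → ℕ
inEdgesAtLeft (α , β) = (if α then 0 else 1) + (if β then 0 else 1)

head-left-vₘ : ∀ {m} (D : Vec (Bool × Bool) m) j →
  headBy (intoSecond D) (left j , vₘ m) ≡ (if proj₁ (lookup D j) then vₘ m else left j)
head-left-vₘ {m} D j
  rewrite dec-true (vₘ m ≟ vₘ m) refl | lookup-extend-left D (true , true) (true , true) j = refl

head-left-vₘ₊₁ : ∀ {m} (D : Vec (Bool × Bool) m) j →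
  headBy (intoSecond D) (left j , vₘ₊₁ m) ≡ (if proj₂ (lookup D j) then vₘ₊₁ m else left j)
head-left-vₘ₊₁ {m} D j
  rewrite dec-false (vₘ₊₁ m ≟ vₘ m) (vₘ≢vₘ₊₁ m ∘ sym)
        | lookup-extend-left D (true , true) (true , true) j = refl

arrivals : ∀ {m} → Vec (Bool × Bool) m → Fin (suc (suc m)) → Fin m → ℕ
arrivals {m} D v j =
  [ headBy (intoSecond D) (left j , vₘ m) ≡ᵛ v ] + [ headBy (intoSecond D) (left j , vₘ₊₁ m) ≡ᵛ v ]

indeg-Kₘ₂ : ∀ {m} (D : Vec (Bool × Bool) m) v →
  indeg (Kₘ₂ m) (orientKₘ₂ D) v ≡ sum (map (arrivals D v) (allFin m))
indeg-Kₘ₂ {m} D v = trans (indeg-orientBy (Kₘ₂ m) (intoSecond D) v) (sum-edges-Kₘ₂ m _)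

arrivals-vₘ : ∀ {m} (D : Vec (Bool × Bool) m) j →
  arrivals D (vₘ m) j ≡ (if proj₁ (lookup D j) then 1 else 0)
arrivals-vₘ {m} D j
  rewrite head-left-vₘ D j | head-left-vₘ₊₁ D j
        | [if-α-then-v]≡ (proj₁ (lookup D j)) (left≢vₘ j)
        | [if]≡0 (proj₂ (lookup D j)) (vₘ≢vₘ₊₁ m ∘ sym) (left≢vₘ j) = +-identityʳ _

arrivals-vₘ₊₁ : ∀ {m} (D : Vec (Bool × Bool) m) j →
  arrivals D (vₘ₊₁ m) j ≡ (if proj₂ (lookup D j) then 1 else 0)
arrivals-vₘ₊₁ {m} D j
  rewrite head-left-vₘ D j | head-left-vₘ₊₁ D j
        | [if]≡0 (proj₁ (lookup D j)) (vₘ≢vₘ₊₁ m) (left≢vₘ₊₁ j)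
        | [if-α-then-v]≡ (proj₂ (lookup D j)) (left≢vₘ₊₁ j) = refl

arrivals-left : ∀ {m} (D : Vec (Bool × Bool) m) j → arrivals D (left j) j ≡ inEdgesAtLeft (lookup D j)
arrivals-left D j rewrite head-left-vₘ D j | head-left-vₘ₊₁ D j =
  cong₂ _+_ ([if-α-else-x]≡ (proj₁ (lookup D j)) (left≢vₘ j ∘ sym))
            ([if-α-else-x]≡ (proj₂ (lookup D j)) (left≢vₘ₊₁ j ∘ sym))

arrivals-left-other : ∀ {m} (D : Vec (Bool × Bool) m) {j₀} j → j ≢ j₀ → arrivals D (left j₀) j ≡ 0
arrivals-left-other D {j₀} j j≢j₀
  rewrite head-left-vₘ D j | head-left-vₘ₊₁ D j
        | [if]≡0 (proj₁ (lookup D j)) (left≢vₘ j₀ ∘ sym) (j≢j₀ ∘ left-injective)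
        | [if]≡0 (proj₂ (lookup D j)) (left≢vₘ₊₁ j₀ ∘ sym) (j≢j₀ ∘ left-injective) = refl

indeg-vₘ : ∀ {m} (D : Vec (Bool × Bool) m) → indeg (Kₘ₂ m) (orientKₘ₂ D) (vₘ m) ≡ countᵇ proj₁ D
indeg-vₘ {m} D = trans (indeg-Kₘ₂ D (vₘ m))
  (trans (sum-map-cong (allFin m) (arrivals-vₘ D)) (sum-allFin-countᵇ proj₁ D))

indeg-vₘ₊₁ : ∀ {m} (D : Vec (Bool × Bool) m) → indeg (Kₘ₂ m) (orientKₘ₂ D) (vₘ₊₁ m) ≡ countᵇ proj₂ D
indeg-vₘ₊₁ {m} D = trans (indeg-Kₘ₂ D (vₘ₊₁ m))
  (trans (sum-map-cong (allFin m) (arrivals-vₘ₊₁ D)) (sum-allFin-countᵇ proj₂ D))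

indeg-left : ∀ {m} (D : Vec (Bool × Bool) m) j →
  indeg (Kₘ₂ m) (orientKₘ₂ D) (left j) ≡ inEdgesAtLeft (lookup D j)
indeg-left D j =
  trans (indeg-Kₘ₂ D (left j)) (trans (sum-allFin-single _ j (arrivals-left-other D)) (arrivals-left D j))

-- Configurations of Kₘ₂

zeros : ∀ {n} → Vec ℕ n → ℕ
zeros = countᵇ (_≡ᵇ 0)

sum-allFin-1∸ : ∀ {n} (xs : Vec ℕ n) → sum (map (λ j → 1 ∸ lookup xs j) (allFin n)) ≡ zeros xs
sum-allFin-1∸ {n} xs =
  trans (sum-map-cong (allFin n) (1∸x≡[x≡0] ∘ lookup xs)) (sum-allFin-countᵇ (_≡ᵇ 0) xs)
  where
  1∸x≡[x≡0] : ∀ x → 1 ∸ x ≡ (if x ≡ᵇ 0 then 1 else 0)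
  1∸x≡[x≡0] zero = refl
  1∸x≡[x≡0] (suc x) = 0∸n≡0 x

suc-∸-∸1 : ∀ d x → suc d ∸ x ∸ 1 ≡ d ∸ x
suc-∸-∸1 d x = trans (∸-+-assoc (suc d) x 1) (cong (suc d ∸_) (+-comm x 1))

lacking-extend : ∀ n (xs : Vec ℕ n) a b →
  lacking (Kₘ₂ (suc n)) (extend xs a b) ≡ zeros xs + (n ∸ a) + (n ∸ b)
lacking-extend n xs a b = begin
  lacking K c
    ≡⟨ sum-vertices n deficit ⟩
  sum (map (deficit ∘ left) (allFin n)) + deficit (vₘ n) + deficit (vₘ₊₁ n)
    ≡⟨ cong₂ _+_ (cong₂ _+_ (trans (sum-map-cong (allFin n) deficit-left) (sum-allFin-1∸ xs)) deficit-vₘ)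
                 deficit-vₘ₊₁ ⟩
  zeros xs + (n ∸ a) + (n ∸ b) ∎
  where
  open ≡-Reasoning
  K = Kₘ₂ (suc n)
  c = extend xs a b
  deficit : Fin (suc (suc n)) → ℕ
  deficit i = deg K (suc i) ∸ lookup c i ∸ 1
  deficit-left : ∀ j → deficit (left j) ≡ 1 ∸ lookup xs j
  deficit-left j = trans (cong₂ (λ d x → d ∸ x ∸ 1) (deg-left (suc n) (suc j)) (lookup-extend-left xs a b j))
                         (suc-∸-∸1 1 (lookup xs j))
  deficit-vₘ : deficit (vₘ n) ≡ n ∸ a
  deficit-vₘ = trans (cong₂ (λ d x → d ∸ x ∸ 1) (deg-vₘ (suc n)) (lookup-extend-vₘ xs a b))
                     (suc-∸-∸1 n a)
  deficit-vₘ₊₁ : deficit (vₘ₊₁ n) ≡ n ∸ b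
  deficit-vₘ₊₁ = trans (cong₂ (λ d x → d ∸ x ∸ 1) (deg-vₘ₊₁ (suc n)) (lookup-extend-vₘ₊₁ xs a b))
                       (suc-∸-∸1 n b)

stable-extend⁻ : ∀ n (xs : Vec ℕ n) a b → Stable (Kₘ₂ (suc n)) (extend xs a b) →
  All (_< 2) xs × a ≤ n × b ≤ n
stable-extend⁻ n xs a b stable =
    lookup⁻ (λ j → subst₂ _<_ (lookup-extend-left xs a b j) (deg-left (suc n) (suc j)) (stable (left j)))
  , s≤s⁻¹ (subst₂ _<_ (lookup-extend-vₘ xs a b) (deg-vₘ (suc n)) (stable (vₘ n)))
  , s≤s⁻¹ (subst₂ _<_ (lookup-extend-vₘ₊₁ xs a b) (deg-vₘ₊₁ (suc n)) (stable (vₘ₊₁ n)))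

stable-extend⁺ : ∀ n (xs : Vec ℕ n) a b → All (_< 2) xs → a ≤ n → b ≤ n →
  Stable (Kₘ₂ (suc n)) (extend xs a b)
stable-extend⁺ n xs a b binary a≤n b≤n = vertex-cases (λ i → lookup c i < deg K (suc i))
  (λ j → subst₂ _<_ (sym (lookup-extend-left xs a b j)) (sym (deg-left (suc n) (suc j))) (lookup⁺ binary j))
  (subst₂ _<_ (sym (lookup-extend-vₘ xs a b)) (sym (deg-vₘ (suc n))) (s≤s a≤n))
  (subst₂ _<_ (sym (lookup-extend-vₘ₊₁ xs a b)) (sym (deg-vₘ₊₁ (suc n))) (s≤s b≤n))
  where
  K = Kₘ₂ (suc n)
  c = extend xs a b

directions : ∀ {k} → Vec ℕ k → ℕ → Vec (Bool × Bool) k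
directions [] p = []
directions (zero ∷ xs) p = (false , false) ∷ directions xs p
directions (suc _ ∷ xs) zero = (false , true) ∷ directions xs zero
directions (suc _ ∷ xs) (suc p) = (true , false) ∷ directions xs p

countᵇ-proj₁-directions : ∀ {k} (xs : Vec ℕ k) p → zeros xs + p ≤ k → countᵇ proj₁ (directions xs p) ≡ p
countᵇ-proj₁-directions [] zero _ = refl
countᵇ-proj₁-directions (zero ∷ xs) p (s≤s z+p≤k) = countᵇ-proj₁-directions xs p z+p≤k
countᵇ-proj₁-directions {suc k} (suc _ ∷ xs) zero _ =
  countᵇ-proj₁-directions xs zero (subst (_≤ k) (sym (+-identityʳ _)) (count≤n (T? ∘ (_≡ᵇ 0)) xs))
countᵇ-proj₁-directions {suc k} (suc _ ∷ xs) (suc p) z+p+1≤k+1 =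
  cong suc (countᵇ-proj₁-directions xs p (s≤s⁻¹ (subst (_≤ suc k) (+-suc (zeros xs) p) z+p+1≤k+1)))

countᵇ-directions : ∀ {k} (xs : Vec ℕ k) p →
  zeros xs + countᵇ proj₁ (directions xs p) + countᵇ proj₂ (directions xs p) ≡ k
countᵇ-directions [] p = refl
countᵇ-directions (zero ∷ xs) p = cong suc (countᵇ-directions xs p)
countᵇ-directions (suc _ ∷ xs) zero = trans (+-suc _ _) (cong suc (countᵇ-directions xs zero))
countᵇ-directions (suc _ ∷ xs) (suc p) =
  trans (cong (_+ countᵇ proj₂ (directions xs p)) (+-suc (zeros xs) _)) (cong suc (countᵇ-directions xs p))

directions-cover-left : ∀ {k} (xs : Vec ℕ k) p j → 2 ∸ lookup xs j ≤ inEdgesAtLeft (lookup (directions xs p) j)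
directions-cover-left (zero ∷ xs) p zero = ≤-refl
directions-cover-left (suc x ∷ xs) zero zero = m∸n≤m 1 x
directions-cover-left (suc x ∷ xs) (suc p) zero = m∸n≤m 1 x
directions-cover-left (zero ∷ xs) p (suc j) = directions-cover-left xs p j
directions-cover-left (suc x ∷ xs) zero (suc j) = directions-cover-left xs zero j
directions-cover-left (suc x ∷ xs) (suc p) (suc j) = directions-cover-left xs p j

suc-∸-≤ : ∀ m n → suc m ∸ n ≤ suc (m ∸ n)
suc-∸-≤ m zero = ≤-refl
suc-∸-≤ zero (suc n) = subst (_≤ 1) (sym (0∸n≡0 n)) z≤n
suc-∸-≤ (suc m) (suc n) = suc-∸-≤ m n

compatible-extend : ∀ n (xs : Vec ℕ n) a b → zeros xs + (n ∸ a) + (n ∸ b) ≤ n →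
  ∃[ O ] Compatible (Kₘ₂ (suc n)) (extend xs a b) O
compatible-extend n xs a b lack≤n =
  O , vertex-cases (λ i → deg K (suc i) ∸ lookup c i ≤ indeg K O (suc i)) at-left at-vₘ at-vₘ₊₁
  where
  K = Kₘ₂ (suc n)
  c = extend xs a b
  D = directions xs (n ∸ a)
  O = orientKₘ₂ ((true , true) ∷ D)
  at-left : ∀ j → deg K (left (suc j)) ∸ lookup c (left j) ≤ indeg K O (left (suc j))
  at-left j = subst₂ _≤_ (sym (cong₂ _∸_ (deg-left (suc n) (suc j)) (lookup-extend-left xs a b j)))
                         (sym (indeg-left ((true , true) ∷ D) (suc j)))
                         (directions-cover-left xs (n ∸ a) j)
  #towardVₘ : countᵇ proj₁ D ≡ n ∸ a
  #towardVₘ = countᵇ-proj₁-directions xs (n ∸ a) (≤-trans (m≤m+n _ (n ∸ b)) lack≤n)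
  at-vₘ : deg K (vₘ (suc n)) ∸ lookup c (vₘ n) ≤ indeg K O (vₘ (suc n))
  at-vₘ = subst₂ _≤_ (sym (cong₂ _∸_ (deg-vₘ (suc n)) (lookup-extend-vₘ xs a b)))
                     (sym (indeg-vₘ ((true , true) ∷ D)))
                     (≤-trans (suc-∸-≤ n a) (s≤s (≤-reflexive (sym #towardVₘ))))
  #towardVₘ₊₁ : n ∸ b ≤ countᵇ proj₂ D
  #towardVₘ₊₁ = +-cancelˡ-≤ (zeros xs + (n ∸ a)) _ _ (begin
    zeros xs + (n ∸ a) + (n ∸ b)              ≤⟨ lack≤n ⟩
    n                                         ≡⟨ countᵇ-directions xs (n ∸ a) ⟨
    zeros xs + countᵇ proj₁ D + countᵇ proj₂ D ≡⟨ cong (λ s → zeros xs + s + countᵇ proj₂ D) #towardVₘ ⟩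
    zeros xs + (n ∸ a) + countᵇ proj₂ D       ∎)
    where open ≤-Reasoning
  at-vₘ₊₁ : deg K (vₘ₊₁ (suc n)) ∸ lookup c (vₘ₊₁ n) ≤ indeg K O (vₘ₊₁ (suc n))
  at-vₘ₊₁ = subst₂ _≤_ (sym (cong₂ _∸_ (deg-vₘ₊₁ (suc n)) (lookup-extend-vₘ₊₁ xs a b)))
                       (sym (indeg-vₘ₊₁ ((true , true) ∷ D)))
                       (≤-trans (suc-∸-≤ n b) (s≤s #towardVₘ₊₁))

InSto⇒lacking≤n : ∀ n c → InSto (Kₘ₂ (suc n)) c → lacking (Kₘ₂ (suc n)) c ≤ n
InSto⇒lacking≤n n c sto = +-cancelʳ-≤ (suc (suc n)) _ _ (begin
  lacking K c + suc (suc n) ≤⟨ lacking+n≤#edges K c sto ⟩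
  length (edges K)          ≡⟨ #edges-Kₘ₂ (suc n) ⟩
  suc n * 2                 ≡⟨ 2[n+1]≡n+[n+2] n ⟩
  n + suc (suc n)           ∎)
  where
  open ≤-Reasoning
  K = Kₘ₂ (suc n)
  2[n+1]≡n+[n+2] : ∀ n → suc n * 2 ≡ n + suc (suc n)
  2[n+1]≡n+[n+2] = solve-∀

stable⇒lacking≤n⇒InSto : ∀ n c → Stable (Kₘ₂ (suc n)) c → lacking (Kₘ₂ (suc n)) c ≤ n →
  InSto (Kₘ₂ (suc n)) c
stable⇒lacking≤n⇒InSto n c stable lack≤n with extend-surjective c
... | xs , a , b , refl =
  stable , compatible-extend n xs a b (subst (_≤ n) (lacking-extend n xs a b) lack≤n)

-- Counting

binaries : ∀ n → ℕ → List (Vec ℕ n)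
binaries zero zero = [] ∷ []
binaries zero (suc r) = []
binaries (suc n) zero = map (1 ∷_) (binaries n zero)
binaries (suc n) (suc r) = map (0 ∷_) (binaries n r) ++ map (1 ∷_) (binaries n (suc r))

length-binaries : ∀ n r → length (binaries n r) ≡ n C r
length-binaries zero zero = refl
length-binaries zero (suc r) = refl
length-binaries (suc n) zero = trans (length-map (1 ∷_) (binaries n zero)) (length-binaries n zero)
length-binaries (suc n) (suc r) = begin
  length (map (0 ∷_) (binaries n r) ++ map (1 ∷_) (binaries n (suc r)))
    ≡⟨ length-++ (map (0 ∷_) (binaries n r)) ⟩
  length (map (0 ∷_) (binaries n r)) + length (map (1 ∷_) (binaries n (suc r)))
    ≡⟨ cong₂ _+_ (length-map (0 ∷_) (binaries n r)) (length-map (1 ∷_) (binaries n (suc r))) ⟩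
  length (binaries n r) + length (binaries n (suc r))
    ≡⟨ cong₂ _+_ (length-binaries n r) (length-binaries n (suc r)) ⟩
  n C r + n C suc r
    ≡⟨ nCk+nC[k+1]≡[n+1]C[k+1] n r ⟩
  suc n C suc r ∎
  where open ≡-Reasoning

binaries-unique : ∀ n r → Unique (binaries n r)
binaries-unique zero zero = [] ∷ []
binaries-unique zero (suc r) = []
binaries-unique (suc n) zero = map⁺ ∷-injectiveʳ (binaries-unique n zero)
binaries-unique (suc n) (suc r) =
  ++⁺ (map⁺ ∷-injectiveʳ (binaries-unique n r)) (map⁺ ∷-injectiveʳ (binaries-unique n (suc r))) disjoint
  where
  disjoint : Disjoint (map (0 ∷_) (binaries n r)) (map (1 ∷_) (binaries n (suc r)))
  disjoint (xs∈ , ys∈) with ∈-map⁻ (0 ∷_) xs∈ | ∈-map⁻ (1 ∷_) ys∈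
  ... | _ , _ , refl | _ , _ , ()

∈-binaries⁻ : ∀ n r (xs : Vec ℕ n) → xs ∈ binaries n r → All (_< 2) xs × zeros xs ≡ r
∈-binaries⁻ zero zero [] _ = [] , refl
∈-binaries⁻ (suc n) zero _ xs∈ with ∈-map⁻ (1 ∷_) xs∈
... | ys , ys∈ , refl =
  let binary , zeros≡ = ∈-binaries⁻ n zero ys ys∈ in (s≤s (s≤s z≤n) ∷ binary) , zeros≡
∈-binaries⁻ (suc n) (suc r) _ xs∈ with ∈-++⁻ (map (0 ∷_) (binaries n r)) xs∈
... | inj₁ xs∈₀ with ∈-map⁻ (0 ∷_) xs∈₀
...   | ys , ys∈ , refl =
  let binary , zeros≡ = ∈-binaries⁻ n r ys ys∈ in (s≤s z≤n ∷ binary) , cong suc zeros≡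
∈-binaries⁻ (suc n) (suc r) _ xs∈ | inj₂ xs∈₁ with ∈-map⁻ (1 ∷_) xs∈₁
...   | ys , ys∈ , refl =
  let binary , zeros≡ = ∈-binaries⁻ n (suc r) ys ys∈ in (s≤s (s≤s z≤n) ∷ binary) , zeros≡

∈-binaries⁺ : ∀ n (xs : Vec ℕ n) → All (_< 2) xs → xs ∈ binaries n (zeros xs)
∈-binaries⁺ zero [] [] = here refl
∈-binaries⁺ (suc n) (zero ∷ xs) (_ ∷ binary) = ∈-++⁺ˡ (∈-map⁺ (0 ∷_) (∈-binaries⁺ n xs binary))
∈-binaries⁺ (suc n) (suc zero ∷ xs) (_ ∷ binary) with zeros xs | ∈-binaries⁺ n xs binary
... | zero  | xs∈ = ∈-map⁺ (1 ∷_) xs∈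
... | suc r | xs∈ = ∈-++⁺ʳ (map (0 ∷_) (binaries n r)) (∈-map⁺ (1 ∷_) xs∈)
∈-binaries⁺ (suc n) (suc (suc _) ∷ xs) (s≤s (s≤s ()) ∷ _)

-- The stable configurations with r zeros on the left vertices and lacking q ∸ r at vₘ
-- and k ∸ q at vₘ₊₁; so q is the combined lack of the left vertices and vₘ, which is
-- how the double sum S n k = Σ_{q ≤ k} Σ_{r ≤ q} (n C r) arises.
layer : ∀ n k q r → List (Config (suc (suc n)))
layer n k q r = map (λ xs → extend xs (n ∸ (q ∸ r)) (n ∸ (k ∸ q))) (binaries n r)

enumeration : ∀ n k → List (Config (suc (suc n)))
enumeration n k = concatMap (λ q → concatMap (layer n k q) (upTo (suc q))) (upTo (suc k))

length-enumeration : ∀ n k → length (enumeration n k) ≡ S n k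
length-enumeration n k =
  trans (length-concatMap (λ q → concatMap (layer n k q) (upTo (suc q))) (upTo (suc k)))
    (sum-map-cong (upTo (suc k)) λ q →
  trans (length-concatMap (layer n k q) (upTo (suc q)))
    (sum-map-cong (upTo (suc q)) λ r →
  trans (length-map (λ xs → extend xs (n ∸ (q ∸ r)) (n ∸ (k ∸ q))) (binaries n r)) (length-binaries n r)))

m∸[n∸[n∸[m∸x]]]≡x : ∀ {m n x} → x ≤ m → m ≤ n → m ∸ (n ∸ (n ∸ (m ∸ x))) ≡ x
m∸[n∸[n∸[m∸x]]]≡x {m} {x = x} x≤m m≤n =
  trans (cong (m ∸_) (m∸[m∸n]≡n (≤-trans (m∸n≤m m x) m≤n))) (m∸[m∸n]≡n x≤m)

∈-enumeration⁻ : ∀ {n k c} → c ∈ enumeration n k →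
  ∃[ q ] ∃[ r ] ∃[ xs ] r ≤ q × q ≤ k × xs ∈ binaries n r × c ≡ extend xs (n ∸ (q ∸ r)) (n ∸ (k ∸ q))
∈-enumeration⁻ {n} {k} c∈ with ∈-concatMap⁻′ (λ q → concatMap (layer n k q) (upTo (suc q))) (upTo (suc k)) c∈
... | q , q∈ , c∈q with ∈-concatMap⁻′ (layer n k q) (upTo (suc q)) c∈q
... | r , r∈ , c∈qr with ∈-map⁻ _ c∈qr
... | xs , xs∈ , c≡ = q , r , xs , s≤s⁻¹ (∈-upTo⁻ r∈) , s≤s⁻¹ (∈-upTo⁻ q∈) , xs∈ , c≡

enumeration-unique : ∀ {n k} → k ≤ n → Unique (enumeration n k)
enumeration-unique {n} {k} k≤n =
  concatMap-unique (λ c → k ∸ (n ∸ lookup c (vₘ₊₁ n))) (upTo⁺ (suc k)) layers-unique q-determined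
  where
  layers-unique : ∀ {q} → q ∈ upTo (suc k) → Unique (concatMap (layer n k q) (upTo (suc q)))
  layers-unique {q} q∈ = concatMap-unique (λ c → q ∸ (n ∸ lookup c (vₘ n))) (upTo⁺ (suc q))
    (λ {r} _ → map⁺ extend-injective (binaries-unique n r)) r-determined
    where
    r-determined : ∀ {r c} → r ∈ upTo (suc q) → c ∈ layer n k q r → q ∸ (n ∸ lookup c (vₘ n)) ≡ r
    r-determined {r} r∈ c∈ with ∈-map⁻ _ c∈
    ... | xs , _ , refl =
      trans (cong (λ a → q ∸ (n ∸ a)) (lookup-extend-vₘ xs _ _))
            (m∸[n∸[n∸[m∸x]]]≡x (s≤s⁻¹ (∈-upTo⁻ r∈)) (≤-trans (s≤s⁻¹ (∈-upTo⁻ q∈)) k≤n))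
  q-determined : ∀ {q c} → q ∈ upTo (suc k) → c ∈ concatMap (layer n k q) (upTo (suc q)) →
    k ∸ (n ∸ lookup c (vₘ₊₁ n)) ≡ q
  q-determined {q} q∈ c∈ with ∈-concatMap⁻′ (layer n k q) (upTo (suc q)) c∈
  ... | r , _ , c∈qr with ∈-map⁻ _ c∈qr
  ... | xs , _ , refl =
    trans (cong (λ b → k ∸ (n ∸ b)) (lookup-extend-vₘ₊₁ xs _ _)) (m∸[n∸[n∸[m∸x]]]≡x (s≤s⁻¹ (∈-upTo⁻ q∈)) k≤n)

∈-enumeration⇒InSto : ∀ {n k} → k ≤ n → ∀ c → c ∈ enumeration n k →
  InSto (Kₘ₂ (suc n)) c × lacking (Kₘ₂ (suc n)) c ≡ k
∈-enumeration⇒InSto {n} {k} k≤n c c∈ with ∈-enumeration⁻ {n} {k} c∈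
... | q , r , xs , r≤q , q≤k , xs∈ , refl =
  stable⇒lacking≤n⇒InSto n c stable (subst (_≤ n) (sym lack≡k) k≤n) , lack≡k
  where
  stable = stable-extend⁺ n xs _ _ (proj₁ (∈-binaries⁻ n r xs xs∈)) (m∸n≤m n (q ∸ r)) (m∸n≤m n (k ∸ q))
  lack≡k : lacking (Kₘ₂ (suc n)) c ≡ k
  lack≡k = begin
    lacking (Kₘ₂ (suc n)) c
      ≡⟨ lacking-extend n xs _ _ ⟩
    zeros xs + (n ∸ (n ∸ (q ∸ r))) + (n ∸ (n ∸ (k ∸ q)))
      ≡⟨ cong₂ _+_ (cong₂ _+_ (proj₂ (∈-binaries⁻ n r xs xs∈))
                              (m∸[m∸n]≡n (≤-trans (m∸n≤m q r) (≤-trans q≤k k≤n))))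
                   (m∸[m∸n]≡n (≤-trans (m∸n≤m k q) k≤n)) ⟩
    r + (q ∸ r) + (k ∸ q)
      ≡⟨ cong (_+ (k ∸ q)) (m+[n∸m]≡n r≤q) ⟩
    q + (k ∸ q)
      ≡⟨ m+[n∸m]≡n q≤k ⟩
    k ∎
    where open ≡-Reasoning

InSto⇒∈-enumeration : ∀ {n k} c → InSto (Kₘ₂ (suc n)) c → lacking (Kₘ₂ (suc n)) c ≡ k →
  c ∈ enumeration n k
InSto⇒∈-enumeration {n} {k} c (stable , _) lack≡k with extend-surjective c
... | xs , a , b , refl with stable-extend⁻ n xs a b stable
... | binary , a≤n , b≤n =
  ∈-concatMap⁺′ _ (∈-upTo⁺ (s≤s q≤k)) (∈-concatMap⁺′ (layer n k q) (∈-upTo⁺ (s≤s r≤q)) c∈layer)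
  where
  r = zeros xs
  q = r + (n ∸ a)
  q+t≡k : q + (n ∸ b) ≡ k
  q+t≡k = trans (sym (lacking-extend n xs a b)) lack≡k
  q≤k : q ≤ k
  q≤k = subst (q ≤_) q+t≡k (m≤m+n q (n ∸ b))
  r≤q : r ≤ q
  r≤q = m≤m+n r (n ∸ a)
  a≡ : n ∸ (q ∸ r) ≡ a
  a≡ = trans (cong (n ∸_) (m+n∸m≡n r (n ∸ a))) (m∸[m∸n]≡n a≤n)
  b≡ : n ∸ (k ∸ q) ≡ b
  b≡ = trans (cong (λ k → n ∸ (k ∸ q)) (sym q+t≡k))
             (trans (cong (n ∸_) (m+n∸m≡n q (n ∸ b))) (m∸[m∸n]≡n b≤n))
  c∈layer : extend xs a b ∈ layer n k q r
  c∈layer = subst₂ (λ a′ b′ → extend xs a′ b′ ∈ layer n k q r) a≡ b≡ (∈-map⁺ _ (∈-binaries⁺ n xs binary))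

lackingCoeff-Kₘ₂ : ∀ n k → k ≤ n → LackingCoeff (Kₘ₂ (suc n)) k (S n k)
lackingCoeff-Kₘ₂ n k k≤n =
    enumeration n k
  , enumeration-unique k≤n
  , (λ c → mk⇔ (∈-enumeration⇒InSto k≤n c) (uncurry (InSto⇒∈-enumeration c)))
  , length-enumeration n k

lackingCoeff-Kₘ₂-vanishes : ∀ n k → n < k → LackingCoeff (Kₘ₂ (suc n)) k 0
lackingCoeff-Kₘ₂-vanishes n k n<k =
  [] , [] , (λ c → mk⇔ (λ ()) (λ (sto , lack≡k) → contradiction (k≤n c sto lack≡k) (<⇒≱ n<k))) , refl
  where
  k≤n : ∀ c → InSto (Kₘ₂ (suc n)) c → lacking (Kₘ₂ (suc n)) c ≡ k → k ≤ n
  k≤n c sto lack≡k = subst (_≤ n) lack≡k (InSto⇒lacking≤n n c sto)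

theorem8 : (m : ℕ) → 1 ≤ m →
    ((k : ℕ) → k ≤ m ∸ 1 → LackingCoeff (Kₘ₂ m) k (S (m ∸ 1) k)) ×
    ((k : ℕ) → m ∸ 1 < k → LackingCoeff (Kₘ₂ m) k 0)
theorem8 (suc n) _ = lackingCoeff-Kₘ₂ n , lackingCoeff-Kₘ₂-vanishes n
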